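{- Let $\Gamma$ be an inner ultrahomogeneous group. Then its centre $Z(\Gamma)$ is either trivial or cyclic of order $2$, and in the latter case its nonidentity element is the unique element of order $2$ in $\Gamma$.
   Context: Conjugation is written $g^h=h^{ -1}gh$. A finite partial automorphism of a group $G$ is an isomorphism between two finitely generated subgroups of $G$. A group $\Gamma$ is inner ultrahomogeneous if for every finite partial automorphism $p$ of $\Gamma$ there is some $g\in\Gamma$ such that $a^g=p(a)$ for all $a\in\operatorname{dom}p$. -}

module Defs where

open import Level using (Level; _⊔_)
open import Algebra.Bundles using (Group)
open import Data.List using (List)
open import Data.List.Membership.Propositional using (_∈_)
open import Data.Product using (Σ; ∃; _×_)
open import Data.Sum using (_⊎_)
open import Relation.Nullary using (¬_)

module _ {c ℓ : Level} (G : Group c ℓ) where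
  open Group G

  _^_ : Carrier → Carrier → Carrier
  a ^ g = (g ⁻¹ ∙ a) ∙ g

  data Gen (xs : List Carrier) : Carrier → Set (c ⊔ ℓ) where
    gen  : ∀ {x} → x ∈ xs → Gen xs x
    unit : Gen xs ε
    mul  : ∀ {a b} → Gen xs a → Gen xs b → Gen xs (a ∙ b)
    inv  : ∀ {a} → Gen xs a → Gen xs (a ⁻¹)
    resp : ∀ {a b} → a ≈ b → Gen xs a → Gen xs b

  -- a finite partial automorphism: an isomorphism between the finitely
  -- generated subgroups ⟨dom⟩ and ⟨cod⟩ of G
  record FinitePartialAut : Set (c ⊔ ℓ) where
    field
      dom cod  : List Carrier
      fun      : ∀ {a} → Gen dom a → Carrier
      fun-cong : ∀ {a b} (p : Gen dom a) (q : Gen dom b) → a ≈ b → fun p ≈ fun q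
      fun-hom  : ∀ {a b} (p : Gen dom a) (q : Gen dom b) → fun (mul p q) ≈ fun p ∙ fun q
      fun-inj  : ∀ {a b} (p : Gen dom a) (q : Gen dom b) → fun p ≈ fun q → a ≈ b
      fun-into : ∀ {a} (p : Gen dom a) → Gen cod (fun p)
      fun-onto : ∀ {b} → Gen cod b → Σ Carrier (λ a → Σ (Gen dom a) (λ p → fun p ≈ b))

  open FinitePartialAut

  InnerUltrahomogeneous : Set (c ⊔ ℓ)
  InnerUltrahomogeneous =
    (p : FinitePartialAut) → Σ Carrier λ g →
      ∀ {a} (d : Gen (dom p) a) → (a ^ g) ≈ fun p d

  Central : Carrier → Set (c ⊔ ℓ)
  Central z = ∀ h → z ∙ h ≈ h ∙ z

  HasOrder2 : Carrier → Set ℓ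
  HasOrder2 g = (¬ g ≈ ε) × (g ∙ g ≈ ε)

  CentreTrivial : Set (c ⊔ ℓ)
  CentreTrivial = ∀ z → Central z → z ≈ ε

  CentreIsC2 : Carrier → Set (c ⊔ ℓ)
  CentreIsC2 z = Central z × HasOrder2 z × (∀ w → Central w → (w ≈ ε) ⊎ (w ≈ z))

-- Inversion on the subgroup generated by a central element z is a partial
-- automorphism; realised by a conjugation, which fixes z, it forces z⁻¹ = z.
-- Any two subgroups of order 2 are isomorphic, so any two involutions are
-- conjugate; an involution conjugate to a central one equals it.
module Submission where

open import Defs
open import Level using (_⊔_; lift; lower)
open import Algebra.Bundles using (Group)
open import Axiom.ExcludedMiddle using (ExcludedMiddle)
open import Data.Bool using (Bool; true; false; _xor_)
open import Data.Empty using (⊥-elim)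
open import Data.List using (List; []; _∷_)
open import Data.List.Membership.Propositional using (_∈_)
open import Data.List.Relation.Unary.Any using (here; there)
open import Data.Product using (Σ; ∃; _×_; _,_)
open import Data.Sum using (_⊎_; inj₁; inj₂)
open import Relation.Nullary using (¬_; Dec; yes; no)
open import Relation.Nullary.Decidable using (map′; decidable-stable)
open import Relation.Binary.PropositionalEquality as ≡ using (_≡_)
import Algebra.Properties.Group as GroupProperties
import Relation.Binary.Reasoning.Setoid as SetoidReasoning

module _ {c ℓ} (Γ : Group c ℓ) where
  open Group Γ
  open GroupProperties Γ
  open SetoidReasoning setoid

  central-resp : ∀ {a b} → a ≈ b → Central Γ a → Central Γ b
  central-resp {a} {b} a≈b a-central h = begin
    b ∙ h ≈⟨ ∙-congʳ (sym a≈b) ⟩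
    a ∙ h ≈⟨ a-central h ⟩
    h ∙ a ≈⟨ ∙-congˡ a≈b ⟩
    h ∙ b ∎

  ε-central : Central Γ ε
  ε-central h = trans (identityˡ h) (sym (identityʳ h))

  ∙-central : ∀ {a b} → Central Γ a → Central Γ b → Central Γ (a ∙ b)
  ∙-central {a} {b} a-central b-central h = begin
    (a ∙ b) ∙ h ≈⟨ assoc a b h ⟩
    a ∙ (b ∙ h) ≈⟨ ∙-congˡ (b-central h) ⟩
    a ∙ (h ∙ b) ≈⟨ sym (assoc a h b) ⟩
    (a ∙ h) ∙ b ≈⟨ ∙-congʳ (a-central h) ⟩
    (h ∙ a) ∙ b ≈⟨ assoc h a b ⟩
    h ∙ (a ∙ b) ∎

  ⁻¹-central : ∀ {a} → Central Γ a → Central Γ (a ⁻¹)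
  ⁻¹-central {a} a-central h = begin
    a ⁻¹ ∙ h           ≈⟨ ∙-congˡ (sym (⁻¹-involutive h)) ⟩
    a ⁻¹ ∙ h ⁻¹ ⁻¹     ≈⟨ sym (⁻¹-anti-homo-∙ (h ⁻¹) a) ⟩
    (h ⁻¹ ∙ a) ⁻¹      ≈⟨ ⁻¹-cong (sym (a-central (h ⁻¹))) ⟩
    (a ∙ h ⁻¹) ⁻¹      ≈⟨ ⁻¹-anti-homo-∙ a (h ⁻¹) ⟩
    h ⁻¹ ⁻¹ ∙ a ⁻¹     ≈⟨ ∙-congʳ (⁻¹-involutive h) ⟩
    h ∙ a ⁻¹ ∎

  Gen-central : ∀ {xs a} → (∀ {x} → x ∈ xs → Central Γ x) → Gen Γ xs a → Central Γ a
  Gen-central xs-central (gen x∈xs) = xs-central x∈xs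
  Gen-central xs-central unit       = ε-central
  Gen-central xs-central (mul p q)  = ∙-central (Gen-central xs-central p) (Gen-central xs-central q)
  Gen-central xs-central (inv p)    = ⁻¹-central (Gen-central xs-central p)
  Gen-central xs-central (resp e p) = central-resp e (Gen-central xs-central p)

  ^-central : ∀ {z} → Central Γ z → ∀ h → _^_ Γ z h ≈ z
  ^-central {z} z-central h = begin
    (h ⁻¹ ∙ z) ∙ h ≈⟨ ∙-congʳ (sym (z-central (h ⁻¹))) ⟩
    (z ∙ h ⁻¹) ∙ h ≈⟨ assoc z (h ⁻¹) h ⟩
    z ∙ (h ⁻¹ ∙ h) ≈⟨ ∙-congˡ (inverseˡ h) ⟩
    z ∙ ε          ≈⟨ identityʳ z ⟩
    z ∎

  -- Exponents in ℤ/2, with xor as addition.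
  pow : Carrier → Bool → Carrier
  pow x false = ε
  pow x true  = x

  pow-∙ : ∀ {x} → x ∙ x ≈ ε → ∀ b b′ → pow x b ∙ pow x b′ ≈ pow x (b xor b′)
  pow-∙ {x} x∙x≈ε false b′    = identityˡ (pow x b′)
  pow-∙ {x} x∙x≈ε true  false = identityʳ x
  pow-∙ {x} x∙x≈ε true  true  = x∙x≈ε

  pow-⁻¹ : ∀ {x} → x ∙ x ≈ ε → ∀ b → pow x b ⁻¹ ≈ pow x b
  pow-⁻¹ {x} x∙x≈ε false = ε⁻¹≈ε
  pow-⁻¹ {x} x∙x≈ε true  = sym (inverseʳ-unique x x x∙x≈ε)

  pow-injective : ∀ {x} → ¬ x ≈ ε → ∀ {b b′} → pow x b ≈ pow x b′ → b ≡ b′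
  pow-injective x≉ε {false} {false} _   = ≡.refl
  pow-injective x≉ε {false} {true}  ε≈x = ⊥-elim (x≉ε (sym ε≈x))
  pow-injective x≉ε {true}  {false} x≈ε = ⊥-elim (x≉ε x≈ε)
  pow-injective x≉ε {true}  {true}  _   = ≡.refl

  pow-Gen : ∀ x b → Gen Γ (x ∷ []) (pow x b)
  pow-Gen x false = unit
  pow-Gen x true  = gen (here ≡.refl)

  evaluate : ∀ {xs a} → (∀ {x} → x ∈ xs → Carrier) → Gen Γ xs a → Carrier
  evaluate σ (gen x∈xs) = σ x∈xs
  evaluate σ unit       = ε
  evaluate σ (mul p q)  = evaluate σ p ∙ evaluate σ q
  evaluate σ (inv p)    = evaluate σ p ⁻¹
  evaluate σ (resp _ p) = evaluate σ p

  evaluate-pow : ∀ {x y a} → x ∙ x ≈ ε → y ∙ y ≈ ε → (p : Gen Γ (x ∷ []) a) →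
                 ∃ λ b → a ≈ pow x b × evaluate (λ _ → y) p ≈ pow y b
  evaluate-pow x∙x≈ε y∙y≈ε (gen (here ≡.refl)) = true , refl , refl
  evaluate-pow x∙x≈ε y∙y≈ε unit = false , refl , refl
  evaluate-pow x∙x≈ε y∙y≈ε (mul p q)
    with evaluate-pow x∙x≈ε y∙y≈ε p | evaluate-pow x∙x≈ε y∙y≈ε q
  ... | b , a≈ , σa≈ | b′ , a′≈ , σa′≈ =
    b xor b′ , trans (∙-cong a≈ a′≈) (pow-∙ x∙x≈ε b b′)
             , trans (∙-cong σa≈ σa′≈) (pow-∙ y∙y≈ε b b′)
  evaluate-pow x∙x≈ε y∙y≈ε (inv p) with evaluate-pow x∙x≈ε y∙y≈ε p
  ... | b , a≈ , σa≈ = b , trans (⁻¹-cong a≈) (pow-⁻¹ x∙x≈ε b)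
                         , trans (⁻¹-cong σa≈) (pow-⁻¹ y∙y≈ε b)
  evaluate-pow x∙x≈ε y∙y≈ε (resp a≈a′ p) with evaluate-pow x∙x≈ε y∙y≈ε p
  ... | b , a≈ , σa≈ = b , trans (sym a≈a′) a≈ , σa≈

  inversionAut : (xs : List Carrier) → (∀ {x} → x ∈ xs → Central Γ x) → FinitePartialAut Γ
  inversionAut xs xs-central = record
    { dom      = xs
    ; cod      = xs
    ; fun      = λ {a} _ → a ⁻¹
    ; fun-cong = λ _ _ → ⁻¹-cong
    ; fun-hom  = λ {a} {b} _ q →
        trans (⁻¹-anti-homo-∙ a b) (Gen-central xs-central (inv q) (a ⁻¹))
    ; fun-inj  = λ _ _ → ⁻¹-injective
    ; fun-into = inv
    ; fun-onto = λ {b} q → b ⁻¹ , inv q , ⁻¹-involutive b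
    }

  involutionAut : ∀ {x y} → HasOrder2 Γ x → HasOrder2 Γ y → FinitePartialAut Γ
  involutionAut {x} {y} (x≉ε , x∙x≈ε) (y≉ε , y∙y≈ε) = record
    { dom      = x ∷ []
    ; cod      = y ∷ []
    ; fun      = x↦y
    ; fun-cong = fun-cong
    ; fun-hom  = λ _ _ → refl
    ; fun-inj  = fun-inj
    ; fun-into = fun-into
    ; fun-onto = fun-onto
    }
    where
    x↦y : ∀ {a} → Gen Γ (x ∷ []) a → Carrier
    x↦y = evaluate (λ _ → y)

    fun-cong : ∀ {a a′} (p : Gen Γ (x ∷ []) a) (q : Gen Γ (x ∷ []) a′) → a ≈ a′ → x↦y p ≈ x↦y q
    fun-cong p q a≈a′ with evaluate-pow x∙x≈ε y∙y≈ε p | evaluate-pow x∙x≈ε y∙y≈ε q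
    ... | b , a≈ , σa≈ | b′ , a′≈ , σa′≈
      with pow-injective x≉ε {b} {b′} (trans (sym a≈) (trans a≈a′ a′≈))
    ... | ≡.refl = trans σa≈ (sym σa′≈)

    fun-inj : ∀ {a a′} (p : Gen Γ (x ∷ []) a) (q : Gen Γ (x ∷ []) a′) → x↦y p ≈ x↦y q → a ≈ a′
    fun-inj p q σa≈σa′ with evaluate-pow x∙x≈ε y∙y≈ε p | evaluate-pow x∙x≈ε y∙y≈ε q
    ... | b , a≈ , σa≈ | b′ , a′≈ , σa′≈
      with pow-injective y≉ε {b} {b′} (trans (sym σa≈) (trans σa≈σa′ σa′≈))
    ... | ≡.refl = trans a≈ (sym a′≈)

    fun-into : ∀ {a} (p : Gen Γ (x ∷ []) a) → Gen Γ (y ∷ []) (x↦y p)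
    fun-into p with evaluate-pow x∙x≈ε y∙y≈ε p
    ... | b , _ , σa≈ = resp (sym σa≈) (pow-Gen y b)

    fun-onto : ∀ {a′} → Gen Γ (y ∷ []) a′ → Σ Carrier λ a → Σ (Gen Γ (x ∷ []) a) λ p → x↦y p ≈ a′
    fun-onto q with evaluate-pow y∙y≈ε y∙y≈ε q
    ... | b , a′≈ , _ = pow x b , pow-Gen x b , trans (σ-pow b) (sym a′≈)
      where
      σ-pow : ∀ b → x↦y (pow-Gen x b) ≈ pow y b
      σ-pow false = refl
      σ-pow true  = refl

  module _ (iu : InnerUltrahomogeneous Γ) where

    central⇒involution : ∀ {z} → Central Γ z → z ∙ z ≈ ε
    central⇒involution {z} z-central with iu (inversionAut (z ∷ []) λ { (here ≡.refl) → z-central })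
    ... | h , z^h≈ = begin
      z ∙ z    ≈⟨ ∙-congˡ (trans (sym (^-central z-central h)) (z^h≈ (gen (here ≡.refl)))) ⟩
      z ∙ z ⁻¹ ≈⟨ inverseʳ z ⟩
      ε        ∎

    involutions-conjugate : ∀ {x y} → HasOrder2 Γ x → HasOrder2 Γ y → ∃ λ h → _^_ Γ x h ≈ y
    involutions-conjugate x-order2 y-order2 with iu (involutionAut x-order2 y-order2)
    ... | h , x^h≈ = h , x^h≈ (gen (here ≡.refl))

    central-involution-unique : ∀ {z g} → Central Γ z → HasOrder2 Γ z → HasOrder2 Γ g → g ≈ z
    central-involution-unique z-central z-order2 g-order2
      with involutions-conjugate z-order2 g-order2
    ... | h , z^h≈g = trans (sym z^h≈g) (^-central z-central h)

  module _ (em : ExcludedMiddle (c ⊔ ℓ)) where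

    ≈ε? : ∀ a → Dec (a ≈ ε)
    ≈ε? a = map′ lower (lift {ℓ = c}) em

    centre-trivial-or-nontrivial : CentreTrivial Γ ⊎ ∃ λ z → Central Γ z × ¬ z ≈ ε
    centre-trivial-or-nontrivial with em {∃ λ z → Central Γ z × ¬ z ≈ ε}
    ... | yes nontrivial = inj₂ nontrivial
    ... | no ∄nontrivial = inj₁ λ z z-central →
      decidable-stable (≈ε? z) λ z≉ε → ∄nontrivial (z , z-central , z≉ε)

    centre-≈ε-or : InnerUltrahomogeneous Γ → ∀ {z} → Central Γ z → HasOrder2 Γ z →
                   ∀ w → Central Γ w → (w ≈ ε) ⊎ (w ≈ z)
    centre-≈ε-or iu z-central z-order2 w w-central with ≈ε? w
    ... | yes w≈ε = inj₁ w≈ε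
    ... | no w≉ε  = inj₂ (central-involution-unique iu z-central z-order2
                           (w≉ε , central⇒involution iu w-central))

proposition4p16 : ∀ {c ℓ} → ExcludedMiddle (c ⊔ ℓ) → (Γ : Group c ℓ) → InnerUltrahomogeneous Γ →
    CentreTrivial Γ ⊎
      Σ (Group.Carrier Γ) (λ z → CentreIsC2 Γ z × (∀ g → HasOrder2 Γ g → Group._≈_ Γ g z))
proposition4p16 em Γ iu with centre-trivial-or-nontrivial Γ em
... | inj₁ trivial = inj₁ trivial
... | inj₂ (z , z-central , z≉ε) =
  inj₂ (z , (z-central , z-order2 , centre-≈ε-or Γ em iu z-central z-order2)
          , λ g g-order2 → central-involution-unique Γ iu z-central z-order2 g-order2)
  where
  z-order2 : HasOrder2 Γ z
  z-order2 = z≉ε , central⇒involution Γ iu z-central
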